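{- For every spectral locale $X$, the locale $\mathrm{Patch}(X)$ is Stone, i.e. it is compact and zero-dimensional.
   Context: Setting: univalent type theory with universes, function and propositional extensionality, propositional truncations. Fix base universe $\mathcal{U}$; small means equivalent to a type in $\mathcal{U}$. A frame has carrier in $\mathcal{U}^+$, an $\Omega_{\mathcal{U}}$-valued partial order, top, binary meets, joins of families indexed by types in $\mathcal{U}$, with meets distributing over joins; a locale $X$ has frame $\mathcal{O}(X)$. An open $U$ is compact if for every small directed family $(V_i)$ with $U\le\bigvee V_i$ there exists $i$ with $U\le V_i$; a locale is compact if its top is compact. $X$ is spectral if it is compact, compact opens are closed under binary meets, every open is (unspecified) a join of a small directed family of compact opens, and the type of compact opens is small. An open is clopen if it has a Boolean complement. A locale is zero-dimensional if it has an unspecified small base consisting of clopens (a small base: a family $B:I\to\mathcal{O}$ with $I:\mathcal{U}$ such that every open is the join of a specified small directed subfamily). A nucleus is an inflationary, binary-meet-preserving, idempotent endomap of $\mathcal{O}(X)$; it is Scott continuous if it preserves small directed joins. $\mathrm{Patch}(X)$ is the locale whose frame is the frame of Scott continuous nuclei on $X$ ordered pointwise (finite meets pointwise; the join of a small family $(k_i)_{i:I}$ is $U\mapsto\bigvee_{s:\mathrm{List}(I)}k^*_s(U)$ with $k^*_{(i_0,\dots,i_{n-1})}=k_{i_{n-1}}\circ\dots\circ k_{i_0}$). -}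

module Defs where

open import Level using (Level; _⊔_; Lift; lift; Setω) renaming (suc to lsuc)
open import Data.Product using (Σ; _×_; _,_; proj₁; proj₂)
open import Data.Bool using (Bool; true; false)
open import Data.List using (List; []; _∷_)
import Data.Empty.Polymorphic as E
open import Function using (_∘_; id)
open import Function.Bundles using (_↔_)
open import Relation.Binary.PropositionalEquality using (_≡_)

isProp : ∀ {ℓ} → Set ℓ → Set ℓ
isProp A = (x y : A) → x ≡ y

FunExt : Setω
FunExt = ∀ {a b} {A : Set a} {B : A → Set b} {f g : (x : A) → B x}
         → ((x : A) → f x ≡ g x) → f ≡ g

PropExt : Setω
PropExt = ∀ {ℓ} {P Q : Set ℓ} → isProp P → isProp Q → (P → Q) → (Q → P) → P ≡ Q

record PropTrunc : Setω where
  field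
    ∥_∥      : ∀ {ℓ} → Set ℓ → Set ℓ
    ∣_∣      : ∀ {ℓ} {A : Set ℓ} → A → ∥ A ∥
    ∥∥-prop  : ∀ {ℓ} {A : Set ℓ} → isProp ∥ A ∥
    ∥∥-rec   : ∀ {ℓ ℓ'} {A : Set ℓ} {P : Set ℓ'} → isProp P → (A → P) → ∥ A ∥ → P

-- Frames: carrier in 𝓤⁺, Ω_𝓤-valued partial order (prop-valued, in Set 𝓤),
-- top, binary meets, joins of 𝓤-indexed families, distributivity.
-- A locale X is identified with its frame 𝒪(X).

record Frame (𝓤 : Level) : Set (lsuc (lsuc 𝓤)) where
  infix  4 _≤_
  infixr 7 _∧_
  field
    Carrier   : Set (lsuc 𝓤)
    _≤_       : Carrier → Carrier → Set 𝓤
    ≤-prop    : ∀ x y → isProp (x ≤ y)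
    ≤-refl    : ∀ x → x ≤ x
    ≤-trans   : ∀ {x y z} → x ≤ y → y ≤ z → x ≤ z
    ≤-antisym : ∀ {x y} → x ≤ y → y ≤ x → x ≡ y
    ⊤         : Carrier
    ⊤-max     : ∀ x → x ≤ ⊤
    _∧_       : Carrier → Carrier → Carrier
    ∧-lb₁     : ∀ x y → x ∧ y ≤ x
    ∧-lb₂     : ∀ x y → x ∧ y ≤ y
    ∧-glb     : ∀ {x y z} → z ≤ x → z ≤ y → z ≤ x ∧ y
    ⋁         : {I : Set 𝓤} → (I → Carrier) → Carrier
    ⋁-ub      : ∀ {I : Set 𝓤} (V : I → Carrier) (i : I) → V i ≤ ⋁ V
    ⋁-lub     : ∀ {I : Set 𝓤} (V : I → Carrier) (x : Carrier)
                → ((i : I) → V i ≤ x) → ⋁ V ≤ x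
    distrib   : ∀ {I : Set 𝓤} (x : Carrier) (V : I → Carrier)
                → x ∧ ⋁ V ≡ ⋁ (λ i → x ∧ V i)

-- "Frame data": a carrier with an order and with the frame operations given
-- relationally ("W is the top", "W is the meet of U and V", "W is the join of
-- the family V").  This is used so that Patch(X) can be described by exactly
-- the formulas of the paper without having to construct the proofs (done in
-- the paper before Thm 11) that these formulas again yield Scott continuous
-- nuclei.

record FrameData (𝓤 𝓥 : Level) : Set (lsuc (lsuc 𝓤) ⊔ lsuc 𝓥) where
  field
    Carrier : Set (lsuc 𝓤)
    _≤_     : Carrier → Carrier → Set 𝓥
    IsTop   : Carrier → Set (lsuc 𝓤)
    IsMeet  : Carrier → Carrier → Carrier → Set (lsuc 𝓤)
    IsJoin  : {I : Set 𝓤} → (I → Carrier) → Carrier → Set (lsuc 𝓤)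

frameData : ∀ {𝓤} → Frame 𝓤 → FrameData 𝓤 𝓤
frameData F = record
  { Carrier = Carrier
  ; _≤_     = _≤_
  ; IsTop   = λ W → W ≡ ⊤
  ; IsMeet  = λ U V W → W ≡ U ∧ V
  ; IsJoin  = λ V W → W ≡ ⋁ V
  }
  where open Frame F

module WithPT (pt : PropTrunc) where
  open PropTrunc pt

  isSmall : ∀ (𝓤 : Level) {ℓ} → Set ℓ → Set (lsuc 𝓤 ⊔ ℓ)
  isSmall 𝓤 T = Σ (Set 𝓤) (λ S → S ↔ T)

  module _ {𝓤 𝓥 : Level} (F : FrameData 𝓤 𝓥) where
    open FrameData F

    isDirected : {I : Set 𝓤} → (I → Carrier) → Set (𝓤 ⊔ 𝓥)
    isDirected {I} V = ∥ I ∥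
                     × ((i j : I) → ∥ Σ I (λ k → (V i ≤ V k) × (V j ≤ V k)) ∥)

    isCompactOpen : Carrier → Set (lsuc 𝓤 ⊔ 𝓥)
    isCompactOpen U = {I : Set 𝓤} (V : I → Carrier) → isDirected V
                    → (J : Carrier) → IsJoin V J → U ≤ J
                    → ∥ Σ I (λ i → U ≤ V i) ∥

    isCompact : Set (lsuc 𝓤 ⊔ 𝓥)
    isCompact = (T : Carrier) → IsTop T → isCompactOpen T

    isSpectral : Set (lsuc 𝓤 ⊔ 𝓥)
    isSpectral =
        isCompact
      × ((U V W : Carrier) → IsMeet U V W
            → isCompactOpen U → isCompactOpen V → isCompactOpen W)
      × ((U : Carrier) → ∥ Σ (Set 𝓤) (λ I → Σ (I → Carrier) (λ b →
            ((i : I) → isCompactOpen (b i)) × isDirected b × IsJoin b U)) ∥)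
      × isSmall 𝓤 (Σ Carrier isCompactOpen)

    emptyFam : E.⊥ {𝓤} → Carrier
    emptyFam ()

    binFam : Carrier → Carrier → Lift 𝓤 Bool → Carrier
    binFam U V (lift true)  = U
    binFam U V (lift false) = V

    -- U has a Boolean complement W: U ∧ W = ⊥ and U ∨ W = ⊤
    isClopen : Carrier → Set (lsuc 𝓤)
    isClopen U = Σ Carrier (λ W →
        Σ Carrier (λ M → IsMeet U W M × IsJoin emptyFam M)
      × Σ Carrier (λ T → IsJoin (binFam U W) T × IsTop T))

    isBase : {I : Set 𝓤} → (I → Carrier) → Set (lsuc 𝓤 ⊔ 𝓥)
    isBase {I} B = (U : Carrier) → Σ (Set 𝓤) (λ J → Σ (J → I) (λ β →
        isDirected (B ∘ β) × IsJoin (B ∘ β) U))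

    isZeroDimensional : Set (lsuc 𝓤 ⊔ 𝓥)
    isZeroDimensional = ∥ Σ (Set 𝓤) (λ I → Σ (I → Carrier) (λ B →
        ((i : I) → isClopen (B i)) × isBase B)) ∥

    isStone : Set (lsuc 𝓤 ⊔ 𝓥)
    isStone = isCompact × isZeroDimensional

  module _ {𝓤 : Level} (X : Frame 𝓤) where
    open Frame X

    isNucleus : (Carrier → Carrier) → Set (lsuc 𝓤)
    isNucleus k = ((U : Carrier) → U ≤ k U)
                × ((U V : Carrier) → k (U ∧ V) ≡ k U ∧ k V)
                × ((U : Carrier) → k (k U) ≡ k U)

    isScottContinuous : (Carrier → Carrier) → Set (lsuc 𝓤)
    isScottContinuous k = {I : Set 𝓤} (V : I → Carrier)
                        → isDirected (frameData X) V → k (⋁ V) ≡ ⋁ (k ∘ V)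

    SCNucleus : Set (lsuc 𝓤)
    SCNucleus = Σ (Carrier → Carrier) (λ k → isNucleus k × isScottContinuous k)

    compose* : {I : Set 𝓤} → (I → SCNucleus) → List I → Carrier → Carrier
    compose* k []      = id
    compose* k (i ∷ s) = compose* k s ∘ proj₁ (k i)

    Patch : FrameData 𝓤 (lsuc 𝓤)
    Patch = record
      { Carrier = SCNucleus
      ; _≤_     = λ j k → (U : Carrier) → proj₁ j U ≤ proj₁ k U
      ; IsTop   = λ k → (U : Carrier) → proj₁ k U ≡ ⊤
      ; IsMeet  = λ j k m → (U : Carrier) → proj₁ m U ≡ proj₁ j U ∧ proj₁ k U
      ; IsJoin  = λ {I} k m → (U : Carrier)
                  → proj₁ m U ≡ ⋁ {List I} (λ s → compose* k s U)
      }

-- Patch(X) is compact because the composites k*ₛ of a directed family of Scott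
-- continuous nuclei are directed: if their join is ⊤, compactness of X gives
-- ⊤ ≤ k*ₛ(⊥) for a single list s, and a member kᵢ above all of s is then ⊤.
-- For zero-dimensionality, take compact opens K, L of X. The nucleus
-- (L ∨ -) ∧ (K ⇨ -), which is the meet in the patch of the closed nucleus of L
-- and the open nucleus of K, has the Boolean complement L ⇨ (K ∨ -). So finite
-- joins of these basic nuclei are clopen, with the finite meets of the
-- complements as complements. They form a base: writing a Scott continuous
-- nucleus j as the join of the basic nuclei with L ≤ j K only needs the
-- compact opens below j U, and every such open is below j K for some compact
-- K ≤ U, by Scott continuity of j.
{-# OPTIONS --safe #-}
module Submission where

open import Level using (Level; Lift; lift; lower) renaming (suc to lsuc)
open import Data.Bool using (Bool; true; false; if_then_else_)
import Data.Empty.Polymorphic as Empty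
open import Data.Product using (Σ; _×_; _,_; proj₁; proj₂)
open import Data.List using (List; []; _∷_; _++_)
open import Data.List.Membership.Propositional using (_∈_)
open import Data.List.Membership.Propositional.Properties using (∈-++⁺ˡ; ∈-++⁺ʳ)
open import Data.List.Relation.Unary.Any using (here; there)
open import Data.List.Relation.Unary.All as All using (All; []; _∷_)
open import Data.List.Relation.Unary.All.Properties using (++⁺)
open import Function using (_∘_; id)
open import Function.Bundles using (Inverse; _↔_)
open import Relation.Binary.Core using (_Preserves_⟶_)
open import Relation.Binary.Structures using (IsPartialOrder)
open import Relation.Binary.Lattice using (DistributiveLattice; HeytingAlgebra)
import Relation.Binary.Lattice.Properties.MeetSemilattice as MeetSemilatticeProperties
import Relation.Binary.Lattice.Properties.JoinSemilattice as JoinSemilatticeProperties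
import Relation.Binary.Lattice.Properties.DistributiveLattice as DistributiveLatticeProperties
import Relation.Binary.Lattice.Properties.HeytingAlgebra as HeytingAlgebraProperties
import Relation.Binary.Reasoning.PartialOrder as PartialOrderReasoning
open import Relation.Binary.PropositionalEquality
  using (_≡_; refl; sym; trans; cong; cong₂; isEquivalence)
open import Defs

module TruncationProperties (pt : PropTrunc) where
  open PropTrunc pt

  ∥∥-map : ∀ {a b} {A : Set a} {B : Set b} → (A → B) → ∥ A ∥ → ∥ B ∥
  ∥∥-map f = ∥∥-rec ∥∥-prop (∣_∣ ∘ f)

module FrameLattice {𝓤 : Level} (X : Frame 𝓤) where
  open Frame X

  infixr 6 _∨_
  _∨_ : Carrier → Carrier → Carrier
  U ∨ V = ⋁ {Lift 𝓤 Bool} (λ b → if lower b then U else V)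

  ⊥ : Carrier
  ⊥ = ⋁ {Empty.⊥} (λ ())

  ⊥-min : ∀ U → ⊥ ≤ U
  ⊥-min U = ⋁-lub _ U (λ ())

  ⋁-mono : {I : Set 𝓤} {V W : I → Carrier} → (∀ i → V i ≤ W i) → ⋁ V ≤ ⋁ W
  ⋁-mono {V = V} {W} V≤W = ⋁-lub V (⋁ W) (λ i → ≤-trans (V≤W i) (⋁-ub W i))

  ⋁-cong : {I : Set 𝓤} {V W : I → Carrier} → (∀ i → V i ≡ W i) → ⋁ V ≡ ⋁ W
  ⋁-cong V≡W = ≤-antisym (⋁-mono (≡⇒≤ ∘ V≡W)) (⋁-mono (≡⇒≤ ∘ sym ∘ V≡W))
    where
    ≡⇒≤ : ∀ {U V} → U ≡ V → U ≤ V
    ≡⇒≤ {U} refl = ≤-refl U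

  isPartialOrder : IsPartialOrder _≡_ _≤_
  isPartialOrder = record
    { isPreorder = record
      { isEquivalence = isEquivalence
      ; reflexive     = λ { {U} refl → ≤-refl U }
      ; trans         = ≤-trans
      }
    ; antisym = ≤-antisym
    }

  distributiveLattice : DistributiveLattice (lsuc 𝓤) (lsuc 𝓤) 𝓤
  distributiveLattice = record
    { Carrier = Carrier
    ; _≈_ = _≡_
    ; _≤_ = _≤_
    ; _∨_ = _∨_
    ; _∧_ = _∧_
    ; isDistributiveLattice = record
      { isLattice = record
        { isPartialOrder = isPartialOrder
        ; supremum = λ U V → ⋁-ub _ (lift true) , ⋁-ub _ (lift false)
                           , λ W U≤W V≤W → ⋁-lub _ W λ { (lift true) → U≤W ; (lift false) → V≤W }
        ; infimum = λ U V → ∧-lb₁ U V , ∧-lb₂ U V , λ W → ∧-glb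
        }
      ; ∧-distribˡ-∨ = λ U V W →
          trans (distrib U _) (⋁-cong λ { (lift true) → refl ; (lift false) → refl })
      }
    }

  open DistributiveLattice distributiveLattice public
    using (poset; x≤x∨y; y≤x∨y; ∨-least; x∧y≤x; x∧y≤y; ∧-greatest; ∧-distribˡ-∨)
    renaming (reflexive to ≤-reflexive)
  open MeetSemilatticeProperties (DistributiveLattice.meetSemilattice distributiveLattice) public
    using (∧-monotonic; ∧-comm; ∧-assoc; ∧-idempotent)
  open JoinSemilatticeProperties (DistributiveLattice.joinSemilattice distributiveLattice) public
    using (∨-monotonic)
  open DistributiveLatticeProperties distributiveLattice public
    using (∨-distribˡ-∧; ∧-distribʳ-∨)

  ∧⋁-least : {I : Set 𝓤} {U W : Carrier} {V : I → Carrier}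
           → (∀ i → U ∧ V i ≤ W) → U ∧ ⋁ V ≤ W
  ∧⋁-least {U = U} {W} {V} U∧V≤W =
    ≤-trans (≤-reflexive (distrib U V)) (⋁-lub _ W U∧V≤W)

  ⋁∧-least : {I : Set 𝓤} {U W : Carrier} {V : I → Carrier}
           → (∀ i → V i ∧ U ≤ W) → ⋁ V ∧ U ≤ W
  ⋁∧-least {U = U} {W} {V} V∧U≤W =
    ≤-trans (≤-reflexive (∧-comm (⋁ V) U))
            (∧⋁-least (λ i → ≤-trans (≤-reflexive (∧-comm U (V i))) (V∧U≤W i)))

  ⋁∧⋁-least : {I J : Set 𝓤} {V : I → Carrier} {W : J → Carrier} {U : Carrier}
            → (∀ i j → V i ∧ W j ≤ U) → ⋁ V ∧ ⋁ W ≤ U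
  ⋁∧⋁-least V∧W≤U = ⋁∧-least (λ i → ∧⋁-least (V∧W≤U i))

module Nuclei (pt : PropTrunc) {𝓤 : Level} (X : Frame 𝓤) where
  open PropTrunc pt
  open TruncationProperties pt
  open WithPT pt
  open Frame X
  open FrameLattice X
  open PartialOrderReasoning poset

  private
    𝒪X : FrameData 𝓤 𝓤
    𝒪X = frameData X

  Nucleus : Set (lsuc 𝓤)
  Nucleus = SCNucleus X

  ⟦_⟧ : Nucleus → Carrier → Carrier
  ⟦_⟧ = proj₁

  infix 4 _⊑_
  _⊑_ : Nucleus → Nucleus → Set (lsuc 𝓤)
  j ⊑ k = ∀ U → ⟦ j ⟧ U ≤ ⟦ k ⟧ U

  Monotone : (Carrier → Carrier) → Set (lsuc 𝓤)
  Monotone f = f Preserves _≤_ ⟶ _≤_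

  inflationary : (k : Nucleus) → ∀ U → U ≤ ⟦ k ⟧ U
  inflationary (_ , (k-inflationary , _ , _) , _) = k-inflationary

  preserves-∧ : (k : Nucleus) → ∀ U V → ⟦ k ⟧ (U ∧ V) ≡ ⟦ k ⟧ U ∧ ⟦ k ⟧ V
  preserves-∧ (_ , (_ , k-∧ , _) , _) = k-∧

  idempotent : (k : Nucleus) → ∀ U → ⟦ k ⟧ (⟦ k ⟧ U) ≡ ⟦ k ⟧ U
  idempotent (_ , (_ , _ , k-idempotent) , _) = k-idempotent

  scott-continuous : (k : Nucleus) → isScottContinuous X ⟦ k ⟧
  scott-continuous (_ , _ , k-continuous) = k-continuous

  ∧-preserving⇒monotone : (f : Carrier → Carrier)
                        → (∀ U V → f (U ∧ V) ≡ f U ∧ f V) → Monotone f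
  ∧-preserving⇒monotone f f-∧ {U} {V} U≤V = begin
    f U        ≡⟨ cong f (≤-antisym (∧-greatest (≤-refl U) U≤V) (x∧y≤x U V)) ⟩
    f (U ∧ V)  ≡⟨ f-∧ U V ⟩
    f U ∧ f V  ≤⟨ x∧y≤y (f U) (f V) ⟩
    f V        ∎

  monotone : (k : Nucleus) → Monotone ⟦ k ⟧
  monotone k = ∧-preserving⇒monotone ⟦ k ⟧ (preserves-∧ k)

  monotone-directed : {f : Carrier → Carrier} → Monotone f
                    → {I : Set 𝓤} {V : I → Carrier} → isDirected 𝒪X V → isDirected 𝒪X (f ∘ V)
  monotone-directed f-mono (inhabited , bounded) =
    inhabited , λ i j → ∥∥-map (λ (k , i≤k , j≤k) → k , f-mono i≤k , f-mono j≤k) (bounded i j)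

  ∘-scott-continuous : {f g : Carrier → Carrier} → Monotone f
                     → isScottContinuous X f → isScottContinuous X g → isScottContinuous X (g ∘ f)
  ∘-scott-continuous {f} {g} f-mono f-sc g-sc V V-directed =
    trans (cong g (f-sc V V-directed)) (g-sc (f ∘ V) (monotone-directed f-mono V-directed))

  nucleus : (f : Carrier → Carrier) → Monotone f → (∀ U → U ≤ f U)
          → (∀ U V → f U ∧ f V ≤ f (U ∧ V)) → (∀ U → f (f U) ≤ f U)
          → (∀ {I : Set 𝓤} (V : I → Carrier) → isDirected 𝒪X V → f (⋁ V) ≤ ⋁ (f ∘ V))
          → Nucleus
  nucleus f f-mono f-inflationary f-∧ f-idempotent f-continuous =
    f , (f-inflationary , preserves , idempotent′) , continuous
    where
    preserves : ∀ U V → f (U ∧ V) ≡ f U ∧ f V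
    preserves U V = ≤-antisym (∧-greatest (f-mono (x∧y≤x U V)) (f-mono (x∧y≤y U V))) (f-∧ U V)

    idempotent′ : ∀ U → f (f U) ≡ f U
    idempotent′ U = ≤-antisym (f-idempotent U) (f-inflationary (f U))

    continuous : isScottContinuous X f
    continuous V V-directed =
      ≤-antisym (f-continuous V V-directed) (⋁-lub _ _ (λ i → f-mono (⋁-ub V i)))

  ⊑-fixes : {j k : Nucleus} → j ⊑ k → ∀ U → ⟦ j ⟧ (⟦ k ⟧ U) ≤ ⟦ k ⟧ U
  ⊑-fixes {j} {k} j⊑k U = ≤-trans (j⊑k (⟦ k ⟧ U)) (≤-reflexive (idempotent k U))

  id-nucleus : Nucleus
  id-nucleus = nucleus id id ≤-refl (λ U V → ≤-refl (U ∧ V)) ≤-refl (λ V _ → ≤-refl (⋁ V))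

  ⊤-nucleus : Nucleus
  ⊤-nucleus = nucleus (λ _ → ⊤) (λ _ → ≤-refl ⊤) ⊤-max (λ _ _ → x∧y≤x ⊤ ⊤) (λ _ → ≤-refl ⊤)
    (λ V (inhabited , _) → ∥∥-rec (≤-prop _ _) (⋁-ub (λ _ → ⊤)) inhabited)

  infixr 7 _∧ₙ_
  _∧ₙ_ : Nucleus → Nucleus → Nucleus
  j ∧ₙ k = nucleus (λ U → ⟦ j ⟧ U ∧ ⟦ k ⟧ U)
    (λ U≤V → ∧-monotonic (monotone j U≤V) (monotone k U≤V))
    (λ U → ∧-greatest (inflationary j U) (inflationary k U))
    meet idem continuous
    where
    meet : ∀ U V → (⟦ j ⟧ U ∧ ⟦ k ⟧ U) ∧ (⟦ j ⟧ V ∧ ⟦ k ⟧ V) ≤ ⟦ j ⟧ (U ∧ V) ∧ ⟦ k ⟧ (U ∧ V)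
    meet U V = begin
      (⟦ j ⟧ U ∧ ⟦ k ⟧ U) ∧ (⟦ j ⟧ V ∧ ⟦ k ⟧ V)
        ≤⟨ ∧-greatest (∧-monotonic (x∧y≤x _ _) (x∧y≤x _ _)) (∧-monotonic (x∧y≤y _ _) (x∧y≤y _ _)) ⟩
      (⟦ j ⟧ U ∧ ⟦ j ⟧ V) ∧ (⟦ k ⟧ U ∧ ⟦ k ⟧ V)
        ≡⟨ sym (cong₂ _∧_ (preserves-∧ j U V) (preserves-∧ k U V)) ⟩
      ⟦ j ⟧ (U ∧ V) ∧ ⟦ k ⟧ (U ∧ V) ∎

    idem : ∀ U → ⟦ j ⟧ (⟦ j ⟧ U ∧ ⟦ k ⟧ U) ∧ ⟦ k ⟧ (⟦ j ⟧ U ∧ ⟦ k ⟧ U) ≤ ⟦ j ⟧ U ∧ ⟦ k ⟧ U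
    idem U = ∧-monotonic
      (≤-trans (monotone j (x∧y≤x _ _)) (≤-reflexive (idempotent j U)))
      (≤-trans (monotone k (x∧y≤y _ _)) (≤-reflexive (idempotent k U)))

    continuous : ∀ {I : Set 𝓤} (V : I → Carrier) → isDirected 𝒪X V
               → ⟦ j ⟧ (⋁ V) ∧ ⟦ k ⟧ (⋁ V) ≤ ⋁ (λ i → ⟦ j ⟧ (V i) ∧ ⟦ k ⟧ (V i))
    continuous V V-directed@(_ , bounded) = begin
      ⟦ j ⟧ (⋁ V) ∧ ⟦ k ⟧ (⋁ V)
        ≡⟨ cong₂ _∧_ (scott-continuous j V V-directed) (scott-continuous k V V-directed) ⟩
      ⋁ (⟦ j ⟧ ∘ V) ∧ ⋁ (⟦ k ⟧ ∘ V)
        ≤⟨ ⋁∧⋁-least (λ a b → ∥∥-rec (≤-prop _ _) (λ (c , a≤c , b≤c) →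
             ≤-trans (∧-monotonic (monotone j a≤c) (monotone k b≤c)) (⋁-ub _ c)) (bounded a b)) ⟩
      ⋁ (λ i → ⟦ j ⟧ (V i) ∧ ⟦ k ⟧ (V i)) ∎

  closed-nucleus : Carrier → Nucleus
  closed-nucleus L = nucleus (L ∨_) (∨-monotonic (≤-refl L)) (y≤x∨y L)
    (λ U V → ≤-reflexive (sym (∨-distribˡ-∧ L U V)))
    (λ U → ∨-least (x≤x∨y L U) (≤-refl (L ∨ U)))
    (λ V (inhabited , _) → ∨-least
      (∥∥-rec (≤-prop _ _) (λ i → ≤-trans (x≤x∨y L (V i)) (⋁-ub _ i)) inhabited)
      (⋁-mono (λ i → y≤x∨y L (V i))))

  module Composites {I : Set 𝓤} (k : I → Nucleus) where
    k* : List I → Carrier → Carrier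
    k* = compose* X k

    k*-inflationary : ∀ s U → U ≤ k* s U
    k*-inflationary []      U = ≤-refl U
    k*-inflationary (i ∷ s) U = ≤-trans (inflationary (k i) U) (k*-inflationary s _)

    k*-preserves-∧ : ∀ s U V → k* s (U ∧ V) ≡ k* s U ∧ k* s V
    k*-preserves-∧ []      U V = refl
    k*-preserves-∧ (i ∷ s) U V = trans (cong (k* s) (preserves-∧ (k i) U V)) (k*-preserves-∧ s _ _)

    k*-monotone : ∀ s → Monotone (k* s)
    k*-monotone s = ∧-preserving⇒monotone (k* s) (k*-preserves-∧ s)

    k*-scott-continuous : ∀ s → isScottContinuous X (k* s)
    k*-scott-continuous []      V _ = refl
    k*-scott-continuous (i ∷ s) =
      ∘-scott-continuous {⟦ k i ⟧} {k* s}
        (monotone (k i)) (scott-continuous (k i)) (k*-scott-continuous s)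

    k*-++ : ∀ s t U → k* (s ++ t) U ≡ k* t (k* s U)
    k*-++ []      t U = refl
    k*-++ (i ∷ s) t U = k*-++ s t (⟦ k i ⟧ U)

    k*-≤-++ˡ : ∀ s t U → k* s U ≤ k* (s ++ t) U
    k*-≤-++ˡ s t U = ≤-trans (k*-inflationary t (k* s U)) (≤-reflexive (sym (k*-++ s t U)))

    k*-≤-++ʳ : ∀ s t U → k* t U ≤ k* (s ++ t) U
    k*-≤-++ʳ s t U = ≤-trans (k*-monotone t (k*-inflationary s U)) (≤-reflexive (sym (k*-++ s t U)))

    k*-directed : ∀ U → isDirected 𝒪X (λ s → k* s U)
    k*-directed U = ∣ [] ∣ , λ s t → ∣ s ++ t , k*-≤-++ˡ s t U , k*-≤-++ʳ s t U ∣

    k*-least : (j : Nucleus) → ∀ {s} → All (λ i → k i ⊑ j) s → ∀ U → k* s U ≤ ⟦ j ⟧ U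
    k*-least j []                          U = inflationary j U
    k*-least j {i ∷ s} (kᵢ⊑j ∷ s⊑j) U = begin
      k* s (⟦ k i ⟧ U)      ≤⟨ k*-least j s⊑j (⟦ k i ⟧ U) ⟩
      ⟦ j ⟧ (⟦ k i ⟧ U)     ≤⟨ monotone j (kᵢ⊑j U) ⟩
      ⟦ j ⟧ (⟦ j ⟧ U)       ≡⟨ idempotent j U ⟩
      ⟦ j ⟧ U               ∎

    k*-disjoint : (m : Nucleus) → (∀ i U → ⟦ k i ⟧ U ∧ ⟦ m ⟧ U ≤ U)
                → ∀ s U → k* s U ∧ ⟦ m ⟧ U ≤ U
    k*-disjoint m disjoint []      U = x∧y≤x U _
    k*-disjoint m disjoint (i ∷ s) U = begin
      k* s (⟦ k i ⟧ U) ∧ ⟦ m ⟧ U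
        ≤⟨ ∧-greatest
             (≤-trans (∧-monotonic (≤-refl _) (monotone m (inflationary (k i) U)))
                      (k*-disjoint m disjoint s (⟦ k i ⟧ U)))
             (x∧y≤y _ _) ⟩
      ⟦ k i ⟧ U ∧ ⟦ m ⟧ U
        ≤⟨ disjoint i U ⟩
      U ∎

    join : Nucleus
    join = nucleus J J-monotone (λ U → ⋁-ub _ []) J-∧ J-idempotent J-continuous
      where
      J : Carrier → Carrier
      J U = ⋁ (λ s → k* s U)

      J-monotone : Monotone J
      J-monotone U≤V = ⋁-mono (λ s → k*-monotone s U≤V)

      J-∧ : ∀ U V → J U ∧ J V ≤ J (U ∧ V)
      J-∧ U V = ⋁∧⋁-least λ s t → begin
        k* s U ∧ k* t V                  ≤⟨ ∧-monotonic (k*-≤-++ˡ s t U) (k*-≤-++ʳ s t V) ⟩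
        k* (s ++ t) U ∧ k* (s ++ t) V    ≡⟨ sym (k*-preserves-∧ (s ++ t) U V) ⟩
        k* (s ++ t) (U ∧ V)              ≤⟨ ⋁-ub _ (s ++ t) ⟩
        J (U ∧ V)                        ∎

      J-idempotent : ∀ U → J (J U) ≤ J U
      J-idempotent U = begin
        ⋁ (λ s → k* s (J U))
          ≡⟨ ⋁-cong (λ s → k*-scott-continuous s _ (k*-directed U)) ⟩
        ⋁ (λ s → ⋁ (λ t → k* s (k* t U)))
          ≤⟨ ⋁-lub _ _ (λ s → ⋁-lub _ _ (λ t →
               ≤-trans (≤-reflexive (sym (k*-++ t s U))) (⋁-ub _ (t ++ s)))) ⟩
        J U ∎

      J-continuous : ∀ {I : Set 𝓤} (V : I → Carrier) → isDirected 𝒪X V → J (⋁ V) ≤ ⋁ (J ∘ V)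
      J-continuous V V-directed = ⋁-lub _ _ λ s → begin
        k* s (⋁ V)     ≡⟨ k*-scott-continuous s V V-directed ⟩
        ⋁ (k* s ∘ V)   ≤⟨ ⋁-mono (λ i → ⋁-ub (λ t → k* t (V i)) s) ⟩
        ⋁ (J ∘ V)      ∎

    join-upper : ∀ i → k i ⊑ join
    join-upper i U = ⋁-ub _ (i ∷ [])

    join-least : (j : Nucleus) → (∀ i → k i ⊑ j) → join ⊑ j
    join-least j k⊑j U = ⋁-lub _ _ (λ s → k*-least j (All.universal k⊑j s) U)

    join-disjoint : (m : Nucleus) → (∀ i U → ⟦ k i ⟧ U ∧ ⟦ m ⟧ U ≤ U)
                  → ∀ U → ⟦ join ⟧ U ∧ ⟦ m ⟧ U ≤ U
    join-disjoint m disjoint U = ⋁∧-least (λ s → k*-disjoint m disjoint s U)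

  open Composites public using (join; join-upper; join-least)

  isJoin-intro : {I : Set 𝓤} (k : I → Nucleus) (j : Nucleus)
               → (∀ i → k i ⊑ j) → j ⊑ join k → FrameData.IsJoin (Patch X) k j
  isJoin-intro k j k⊑j j⊑join U = ≤-antisym (j⊑join U) (join-least k j k⊑j U)

  -- In the patch, W is a common fixed point of j and k exactly when W is fixed by j ∨ k.
  complement⇒isClopen : (j k : Nucleus)
                      → (∀ U → ⟦ j ⟧ U ∧ ⟦ k ⟧ U ≤ U)
                      → (∀ W → ⟦ j ⟧ W ≤ W → ⟦ k ⟧ W ≤ W → ⊤ ≤ W)
                      → isClopen (Patch X) j
  complement⇒isClopen j k disjoint only-⊤-fixed =
      k
    , (id-nucleus , meet-is-id , isJoin-intro empty id-nucleus (λ ()) (inflationary (join empty)))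
    , (⊤-nucleus , isJoin-intro pair ⊤-nucleus (λ _ U → ⊤-max _) ⊤⊑join , λ _ → refl)
    where
    empty : Empty.⊥ → Nucleus
    empty = emptyFam (Patch X)

    pair : Lift 𝓤 Bool → Nucleus
    pair = binFam (Patch X) j k

    meet-is-id : ∀ U → U ≡ ⟦ j ⟧ U ∧ ⟦ k ⟧ U
    meet-is-id U = ≤-antisym (∧-greatest (inflationary j U) (inflationary k U)) (disjoint U)

    ⊤⊑join : ⊤-nucleus ⊑ join pair
    ⊤⊑join U = only-⊤-fixed (⟦ join pair ⟧ U) (fixes (lift true)) (fixes (lift false))
      where
      fixes : ∀ b → ⟦ pair b ⟧ (⟦ join pair ⟧ U) ≤ ⟦ join pair ⟧ U
      fixes b = ⊑-fixes {pair b} {join pair} (join-upper pair b) U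

  finite-upper-bound : {I : Set 𝓤} {k : I → Nucleus} → isDirected (Patch X) k
                     → (s : List I) → ∥ Σ I (λ i → All (λ x → k x ⊑ k i) s) ∥
  finite-upper-bound (inhabited , _) [] = ∥∥-map (λ i → i , []) inhabited
  finite-upper-bound {I} {k} k-directed@(_ , bounded) (x ∷ s) =
    ∥∥-rec ∥∥-prop extend (finite-upper-bound {k = k} k-directed s)
    where
    extend : Σ I (λ i → All (λ y → k y ⊑ k i) s) → ∥ Σ I (λ i → All (λ y → k y ⊑ k i) (x ∷ s)) ∥
    extend (i , s⊑i) = ∥∥-map
      (λ (c , x⊑c , i⊑c) → c , x⊑c ∷ All.map (λ y⊑i U → ≤-trans (y⊑i U) (i⊑c U)) s⊑i)
      (bounded x i)

  patch-compact : isCompact 𝒪X → isCompact (Patch X)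
  patch-compact ⊤-compact T T-is-⊤ {I} k k-directed J J-is-join T⊑J =
    ∥∥-rec ∥∥-prop bound (⊤-compact ⊤ refl (λ s → k* s ⊥) (k*-directed ⊥) (⟦ J ⟧ ⊥) (J-is-join ⊥)
                            (≤-trans (≤-reflexive (sym (T-is-⊤ ⊥))) (T⊑J ⊥)))
    where
    open Composites k

    bound : Σ (List I) (λ s → ⊤ ≤ k* s ⊥) → ∥ Σ I (λ i → T ⊑ k i) ∥
    bound (s , ⊤≤k*s⊥) = ∥∥-map
      (λ (i , s⊑kᵢ) → i , λ U → begin
        ⟦ T ⟧ U        ≡⟨ T-is-⊤ U ⟩
        ⊤              ≤⟨ ⊤≤k*s⊥ ⟩
        k* s ⊥         ≤⟨ k*-least (k i) s⊑kᵢ ⊥ ⟩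
        ⟦ k i ⟧ ⊥      ≤⟨ monotone (k i) (⊥-min U) ⟩
        ⟦ k i ⟧ U      ∎)
      (finite-upper-bound {k = k} k-directed s)

module Spectral (pt : PropTrunc) {𝓤 : Level} (X : Frame 𝓤)
                (spec : WithPT.isSpectral pt (frameData X)) where
  open PropTrunc pt
  open TruncationProperties pt
  open WithPT pt
  open Frame X
  open FrameLattice X
  open Nuclei pt X
  open PartialOrderReasoning poset

  private
    𝒪X : FrameData 𝓤 𝓤
    𝒪X = frameData X

    𝒦 : Carrier → Set (lsuc 𝓤)
    𝒦 = isCompactOpen 𝒪X

  S : Set 𝓤
  S = proj₁ (proj₂ (proj₂ (proj₂ spec)))

  private
    S≅𝒦 : S ↔ Σ Carrier 𝒦
    S≅𝒦 = proj₂ (proj₂ (proj₂ (proj₂ spec)))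

  ι : S → Carrier
  ι K = proj₁ (Inverse.to S≅𝒦 K)

  ι-compact : ∀ K → 𝒦 (ι K)
  ι-compact K = proj₂ (Inverse.to S≅𝒦 K)

  index : ∀ {C} → 𝒦 C → Σ S (λ K → ι K ≡ C)
  index {C} C-compact =
    Inverse.from S≅𝒦 (C , C-compact) , cong proj₁ (Inverse.strictlyInverseˡ S≅𝒦 (C , C-compact))

  compact-∧ : ∀ {U V} → 𝒦 U → 𝒦 V → 𝒦 (U ∧ V)
  compact-∧ = proj₁ (proj₂ spec) _ _ _ refl

  compact-below-directed : ∀ {C} {I : Set 𝓤} {V : I → Carrier} → 𝒦 C → isDirected 𝒪X V
                         → C ≤ ⋁ V → ∥ Σ I (λ i → C ≤ V i) ∥
  compact-below-directed C-compact V-directed = C-compact _ V-directed _ refl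

  DirectedCompactCover : Carrier → Set (lsuc 𝓤)
  DirectedCompactCover U = Σ (Set 𝓤) (λ I → Σ (I → Carrier) (λ b →
    ((i : I) → 𝒦 (b i)) × isDirected 𝒪X b × U ≡ ⋁ b))

  directed-compact-cover : ∀ U → ∥ DirectedCompactCover U ∥
  directed-compact-cover = proj₁ (proj₂ (proj₂ spec))

  ≤-by-compacts : ∀ {U W} → (∀ K → ι K ≤ U → ι K ≤ W) → U ≤ W
  ≤-by-compacts {U} {W} compacts-below =
    ∥∥-rec (≤-prop U W) by-cover (directed-compact-cover U)
    where
    by-cover : DirectedCompactCover U → U ≤ W
    by-cover (_ , b , b-compact , _ , U≡⋁b) =
      ≤-trans (≤-reflexive U≡⋁b) (⋁-lub b W (λ i → member (index (b-compact i)) (⋁-ub b i)))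
      where
      member : ∀ {B} → Σ S (λ K → ι K ≡ B) → B ≤ ⋁ b → B ≤ W
      member (K , refl) K≤⋁b = compacts-below K (≤-trans K≤⋁b (≤-reflexive (sym U≡⋁b)))

  -- Indexing by S, the small type of compact opens, keeps this join 𝓤-indexed.
  infixr 5 _⇨_
  _⇨_ : Carrier → Carrier → Carrier
  U ⇨ V = ⋁ {Σ S (λ K → ι K ∧ U ≤ V)} (ι ∘ proj₁)

  heytingAlgebra : HeytingAlgebra (lsuc 𝓤) (lsuc 𝓤) 𝓤
  heytingAlgebra = record
    { Carrier = Carrier
    ; _≈_ = _≡_
    ; _≤_ = _≤_
    ; _∨_ = _∨_
    ; _∧_ = _∧_
    ; _⇨_ = _⇨_
    ; ⊤ = ⊤
    ; ⊥ = ⊥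
    ; isHeytingAlgebra = record
      { isBoundedLattice = record
        { isLattice = DistributiveLattice.isLattice distributiveLattice
        ; maximum = ⊤-max
        ; minimum = ⊥-min
        }
      ; exponential = λ W U V → transpose W U V , λ W≤U⇨V →
          ≤-trans (∧-monotonic W≤U⇨V (≤-refl U)) (⋁∧-least proj₂)
      }
    }
    where
    transpose : ∀ W U V → W ∧ U ≤ V → W ≤ U ⇨ V
    transpose W U V W∧U≤V = ≤-by-compacts λ K K≤W →
      ⋁-ub (ι ∘ proj₁) (K , ≤-trans (∧-monotonic K≤W (≤-refl U)) W∧U≤V)

  open HeytingAlgebra heytingAlgebra using (transpose-⇨)
  open HeytingAlgebraProperties heytingAlgebra
    using (⇨-eval; y≤x⇨y; ⇨ʳ-covariant; ⇨-distribˡ-∧-≥; ⇨-curry)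

  ⇨∧∨≤ : ∀ U V → (U ⇨ V) ∧ (U ∨ V) ≤ V
  ⇨∧∨≤ U V = begin
    (U ⇨ V) ∧ (U ∨ V)                ≡⟨ ∧-distribˡ-∨ (U ⇨ V) U V ⟩
    (U ⇨ V) ∧ U ∨ (U ⇨ V) ∧ V        ≤⟨ ∨-least ⇨-eval (x∧y≤y _ _) ⟩
    V                                ∎

  open-nucleus : S → Nucleus
  open-nucleus K = nucleus (ι K ⇨_) ⇨ʳ-covariant (λ _ → y≤x⇨y)
    (λ U V → ⇨-distribˡ-∧-≥ (ι K) U V)
    (λ U → ≤-reflexive (trans (sym ⇨-curry) (cong (_⇨ U) (∧-idempotent (ι K)))))
    continuous
    where
    continuous : ∀ {I : Set 𝓤} (V : I → Carrier) → isDirected 𝒪X V → ι K ⇨ ⋁ V ≤ ⋁ (λ i → ι K ⇨ V i)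
    continuous V V-directed = ⋁-lub _ _ λ (K′ , K′∧K≤⋁V) →
      ∥∥-rec (≤-prop _ _) (λ (i , K′∧K≤Vᵢ) → ≤-trans (transpose-⇨ K′∧K≤Vᵢ) (⋁-ub _ i))
        (compact-below-directed (compact-∧ (ι-compact K′) (ι-compact K)) V-directed K′∧K≤⋁V)

  basic : S × S → Nucleus
  basic (K , L) = closed-nucleus (ι L) ∧ₙ open-nucleus K

  basicᶜ : S × S → Nucleus
  basicᶜ (K , L) = nucleus (⟦ o ⟧ ∘ ⟦ c ⟧)
    (monotone o ∘ monotone c)
    (λ U → ≤-trans (inflationary c U) (inflationary o _))
    (λ U V → ≤-reflexive (sym (trans (cong ⟦ o ⟧ (preserves-∧ c U V)) (preserves-∧ o _ _))))
    idem
    (λ V V-directed → ≤-reflexive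
      (∘-scott-continuous {⟦ c ⟧} {⟦ o ⟧}
        (monotone c) (scott-continuous c) (scott-continuous o) V V-directed))
    where
    c : Nucleus
    c = closed-nucleus (ι K)

    o : Nucleus
    o = open-nucleus L

    idem : ∀ U → ι L ⇨ ι K ∨ (ι L ⇨ ι K ∨ U) ≤ ι L ⇨ ι K ∨ U
    idem U = transpose-⇨ (begin
      (ι L ⇨ ι K ∨ (ι L ⇨ ι K ∨ U)) ∧ ι L  ≤⟨ ∧-greatest ⇨-eval (x∧y≤y _ _) ⟩
      (ι K ∨ (ι L ⇨ ι K ∨ U)) ∧ ι L        ≡⟨ ∧-distribʳ-∨ (ι L) (ι K) _ ⟩
      ι K ∧ ι L ∨ (ι L ⇨ ι K ∨ U) ∧ ι L    ≤⟨ ∨-monotonic (x∧y≤x _ _) ⇨-eval ⟩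
      ι K ∨ (ι K ∨ U)                      ≤⟨ ∨-least (x≤x∨y _ _) (≤-refl _) ⟩
      ι K ∨ U                              ∎)

  basic∧basicᶜ≤id : ∀ x U → ⟦ basic x ⟧ U ∧ ⟦ basicᶜ x ⟧ U ≤ U
  basic∧basicᶜ≤id (K , L) U = begin
    ((ι L ∨ U) ∧ (ι K ⇨ U)) ∧ (ι L ⇨ ι K ∨ U)
      ≤⟨ ∧-greatest (≤-trans (x∧y≤x _ _) (x∧y≤y _ _))
                    (∧-greatest (x∧y≤y _ _)
                                (≤-trans (x∧y≤x _ _) (≤-trans (x∧y≤x _ _)
                                         (∨-monotonic (≤-refl _) (y≤x∨y (ι K) U))))) ⟩
    (ι K ⇨ U) ∧ ((ι L ⇨ ι K ∨ U) ∧ (ι L ∨ (ι K ∨ U)))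
      ≤⟨ ∧-monotonic (≤-refl _) (⇨∧∨≤ (ι L) (ι K ∨ U)) ⟩
    (ι K ⇨ U) ∧ (ι K ∨ U)
      ≤⟨ ⇨∧∨≤ (ι K) U ⟩
    U ∎

  -- A pointwise form of basic x ∨ basicᶜ x = ⊤; the parameter A lets it iterate over ⋀basicᶜ.
  basicᶜ-cancel : ∀ x {A W} → ⟦ basic x ⟧ W ≤ W → A ∧ ⟦ basicᶜ x ⟧ W ≤ W → A ≤ W
  basicᶜ-cancel (K , L) {A} {W} basic-fixes A∧basicᶜ≤W =
    ≤-trans (∧-greatest (≤-refl A) A≤basicᶜ) A∧basicᶜ≤W
    where
    A∧K≤W : A ∧ ι K ≤ W
    A∧K≤W = ≤-trans (∧-monotonic (≤-refl A) (transpose-⇨ (≤-trans (x∧y≤x _ _) (x≤x∨y _ _))))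
                    A∧basicᶜ≤W

    A∧L≤W : A ∧ ι L ≤ W
    A∧L≤W = begin
      A ∧ ι L                ≤⟨ ∧-greatest (≤-trans (x∧y≤y _ _) (x≤x∨y _ _))
                                           (≤-trans (x∧y≤x _ _) (transpose-⇨ A∧K≤W)) ⟩
      (ι L ∨ W) ∧ (ι K ⇨ W)  ≤⟨ basic-fixes ⟩
      W                      ∎

    A≤basicᶜ : A ≤ ι L ⇨ ι K ∨ W
    A≤basicᶜ = transpose-⇨ (≤-trans A∧L≤W (y≤x∨y _ _))

  Member : List (S × S) → Set 𝓤
  Member s = Σ (S × S) (_∈ s)

  ⋁basic : List (S × S) → Nucleus
  ⋁basic s = join {Member s} (basic ∘ proj₁)

  ⋀basicᶜ : List (S × S) → Nucleus
  ⋀basicᶜ []      = ⊤-nucleus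
  ⋀basicᶜ (x ∷ s) = basicᶜ x ∧ₙ ⋀basicᶜ s

  ⋀basicᶜ-⊑ : ∀ {x s} → x ∈ s → ⋀basicᶜ s ⊑ basicᶜ x
  ⋀basicᶜ-⊑ (here refl) U = x∧y≤x _ _
  ⋀basicᶜ-⊑ (there x∈s) U = ≤-trans (x∧y≤y _ _) (⋀basicᶜ-⊑ x∈s U)

  ⋀basicᶜ-cancel : ∀ s {A W} → All (λ x → ⟦ basic x ⟧ W ≤ W) s
                 → A ∧ ⟦ ⋀basicᶜ s ⟧ W ≤ W → A ≤ W
  ⋀basicᶜ-cancel []      {A} [] A∧⊤≤W = ≤-trans (∧-greatest (≤-refl A) (⊤-max A)) A∧⊤≤W
  ⋀basicᶜ-cancel (x ∷ s) {A} (x-fixes ∷ s-fix) A∧⋀≤W =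
    basicᶜ-cancel x x-fixes
      (⋀basicᶜ-cancel s s-fix (≤-trans (≤-reflexive (∧-assoc A _ _)) A∧⋀≤W))

  ⋁basic-isClopen : ∀ s → isClopen (Patch X) (⋁basic s)
  ⋁basic-isClopen s = complement⇒isClopen (⋁basic s) (⋀basicᶜ s)
    (Composites.join-disjoint (basic ∘ proj₁) (⋀basicᶜ s) λ (x , x∈s) U →
      ≤-trans (∧-monotonic (≤-refl _) (⋀basicᶜ-⊑ x∈s U)) (basic∧basicᶜ≤id x U))
    (λ W ⋁basic-fixes ⋀basicᶜ-fixes → ⋀basicᶜ-cancel s
      (All.tabulate λ {x} x∈s → ≤-trans (join-upper _ (x , x∈s) W) ⋁basic-fixes)
      (≤-trans (x∧y≤y _ _) ⋀basicᶜ-fixes))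

  infix 4 _◁_
  _◁_ : S × S → Nucleus → Set 𝓤
  (K , L) ◁ j = ι L ≤ ⟦ j ⟧ (ι K)

  basic-⊑ : ∀ {x j} → x ◁ j → basic x ⊑ j
  basic-⊑ {K , L} {j} L≤jK U = begin
    (ι L ∨ U) ∧ (ι K ⇨ U)                    ≡⟨ ∧-distribʳ-∨ _ (ι L) U ⟩
    ι L ∧ (ι K ⇨ U) ∨ U ∧ (ι K ⇨ U)
      ≤⟨ ∨-least L∧K⇨U≤jU (≤-trans (x∧y≤x _ _) (inflationary j U)) ⟩
    ⟦ j ⟧ U                                  ∎
    where
    L∧K⇨U≤jU : ι L ∧ (ι K ⇨ U) ≤ ⟦ j ⟧ U
    L∧K⇨U≤jU = begin
      ι L ∧ (ι K ⇨ U)                  ≤⟨ ∧-monotonic L≤jK (inflationary j _) ⟩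
      ⟦ j ⟧ (ι K) ∧ ⟦ j ⟧ (ι K ⇨ U)    ≡⟨ sym (preserves-∧ j _ _) ⟩
      ⟦ j ⟧ (ι K ∧ (ι K ⇨ U))          ≤⟨ monotone j (≤-trans (≤-reflexive (∧-comm _ _)) ⇨-eval) ⟩
      ⟦ j ⟧ U                          ∎

  ≤-basic : ∀ {K L U} → ι K ≤ U → ι L ≤ ⟦ basic (K , L) ⟧ U
  ≤-basic {U = U} K≤U =
    ∧-greatest (x≤x∨y _ U) (transpose-⇨ (≤-trans (x∧y≤y _ _) K≤U))

  ⋁basic-⊑ : ∀ {s j} → All (_◁ j) s → ⋁basic s ⊑ j
  ⋁basic-⊑ {j = j} s◁j =
    join-least (basic ∘ proj₁) j λ (x , x∈s) → basic-⊑ {x} {j} (All.lookup s◁j x∈s)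

  ⋁basic-mono : ∀ {s t} → (∀ {x} → x ∈ s → x ∈ t) → ⋁basic s ⊑ ⋁basic t
  ⋁basic-mono {t = t} s⊆t =
    join-least (basic ∘ proj₁) (⋁basic t) λ (x , x∈s) → join-upper (basic ∘ proj₁) (x , s⊆t x∈s)

  Below : Nucleus → Set 𝓤
  Below j = Σ (List (S × S)) (All (_◁ j))

  below-directed : ∀ j → isDirected (Patch X) {Below j} (⋁basic ∘ proj₁)
  below-directed j = ∣ [] , [] ∣ , λ (s , s◁j) (t , t◁j) →
    ∣ (s ++ t , ++⁺ s◁j t◁j) , ⋁basic-mono ∈-++⁺ˡ , ⋁basic-mono (∈-++⁺ʳ s) ∣

  compact-below-nucleus : ∀ j {C U} → 𝒦 C → C ≤ ⟦ j ⟧ U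
                        → ∥ Σ S (λ K → ι K ≤ U × C ≤ ⟦ j ⟧ (ι K)) ∥
  compact-below-nucleus j {C} {U} C-compact C≤jU =
    ∥∥-rec ∥∥-prop by-cover (directed-compact-cover U)
    where
    by-cover : DirectedCompactCover U → ∥ Σ S (λ K → ι K ≤ U × C ≤ ⟦ j ⟧ (ι K)) ∥
    by-cover (_ , b , b-compact , b-directed , U≡⋁b) =
      ∥∥-map (λ (i , C≤jbᵢ) → member (index (b-compact i)) (⋁-ub b i) C≤jbᵢ)
        (compact-below-directed C-compact (monotone-directed (monotone j) b-directed) (begin
          C              ≤⟨ C≤jU ⟩
          ⟦ j ⟧ U        ≡⟨ cong ⟦ j ⟧ U≡⋁b ⟩
          ⟦ j ⟧ (⋁ b)    ≡⟨ scott-continuous j b b-directed ⟩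
          ⋁ (⟦ j ⟧ ∘ b)  ∎))
      where
      member : ∀ {B} → Σ S (λ K → ι K ≡ B) → B ≤ ⋁ b → C ≤ ⟦ j ⟧ B
             → Σ S (λ K → ι K ≤ U × C ≤ ⟦ j ⟧ (ι K))
      member (K , refl) K≤⋁b C≤jK = K , ≤-trans K≤⋁b (≤-reflexive (sym U≡⋁b)) , C≤jK

  ⊑-join-below : ∀ j → j ⊑ join {Below j} (⋁basic ∘ proj₁)
  ⊑-join-below j U = ≤-by-compacts λ L L≤jU →
    ∥∥-rec (≤-prop _ _)
      (λ (K , K≤U , L≤jK) → begin
        ι L                                          ≤⟨ ≤-basic K≤U ⟩
        ⟦ basic (K , L) ⟧ U                          ≤⟨ join-upper _ ((K , L) , here refl) U ⟩
        ⟦ ⋁basic ((K , L) ∷ []) ⟧ U                  ≤⟨ join-upper _ ((K , L) ∷ [] , L≤jK ∷ []) U ⟩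
        ⟦ join {Below j} (⋁basic ∘ proj₁) ⟧ U        ∎)
      (compact-below-nucleus j (ι-compact L) L≤jU)

  ⋁basic-isBase : isBase (Patch X) ⋁basic
  ⋁basic-isBase j = Below j , proj₁ , below-directed j
    , isJoin-intro (⋁basic ∘ proj₁) j (λ (s , s◁j) → ⋁basic-⊑ {s} {j} s◁j) (⊑-join-below j)

  patch-zero-dimensional : isZeroDimensional (Patch X)
  patch-zero-dimensional = ∣ List (S × S) , ⋁basic , ⋁basic-isClopen , ⋁basic-isBase ∣

mainTheorem11 : (pt : PropTrunc) → FunExt → PropExt
    → ∀ {𝓤} (X : Frame 𝓤)
    → WithPT.isSpectral pt (frameData X)
    → WithPT.isStone pt (WithPT.Patch pt X)
mainTheorem11 pt _ _ X spec =
  Nuclei.patch-compact pt X (proj₁ spec) , Spectral.patch-zero-dimensional pt X spec
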